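{- For positive integers $n\ge k\ge d$, we have $J^{\mathbb{Q},\mathbf{t}}_{n,k,d}\subseteq\mathbf{I}(\mathcal{Z}_{n,k,d})$ as ideals of $\mathbb{Q}[\mathbf{x}_n,\mathbf{y}_d,\mathbf{t}_k]$.
   Context: $\mathbb{Q}[\mathbf{x}_n,\mathbf{y}_d,\mathbf{t}_k]$ is the coordinate ring of $\mathbb{Q}^{n+d+k}$ with coordinates $(x_1,\dots,x_n;y_1,\dots,y_d;t_1,\dots,t_k)$. $\mathcal{Z}_{n,k,d}\subseteq\mathbb{Q}^{n+d+k}$ is the set of points for which there exist an injective map $f:[d]\to[k]$ with $y_i=t_{f(i)}$ for all $i$ and a surjective map $g:[n]\to[d]$ with $x_j=y_{g(j)}$ for all $j$; $\mathbf{I}(\mathcal{Z})$ is its vanishing ideal. $J^{\mathbb{Q},\mathbf{t}}_{n,k,d}$ is the ideal generated by: $e_r(\mathbf{t}_k)-e_{r-1}(\mathbf{t}_k)h_1(\mathbf{y}_d)+\cdots+(-1)^rh_r(\mathbf{y}_d)$ for $r>k-d$; $e_r(\mathbf{x}_n)-e_{r-1}(\mathbf{x}_n)h_1(\mathbf{y}_d)+\cdots+(-1)^rh_r(\mathbf{y}_d)$ for $r>n-d$; and $x_i^d-x_i^{d-1}e_1(\mathbf{y}_d)+\cdots+(-1)^de_d(\mathbf{y}_d)$ for $1\le i\le n$. -}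

module Defs where

open import Data.Nat using (ℕ; zero; suc; _∸_; _<_)
open import Data.Fin using (Fin)
open import Data.Sum using (_⊎_; inj₁; inj₂)
open import Data.Product using (Σ; ∃; _×_; _,_)
open import Data.List using (List; []; _∷_)
open import Data.Rational using (ℚ; 0ℚ; 1ℚ) renaming (_+_ to _+ℚ_; _*_ to _*ℚ_; -_ to -ℚ_)
open import Function.Definitions using (Injective; Surjective)
open import Relation.Binary.PropositionalEquality using (_≡_)

-- Two expressions denote the same polynomial iff they agree as functions
-- on ℚ^V (ℚ is infinite); this is used in the ideal closure below.

infixl 6 _⊕_
infixl 7 _⊗_

data Poly (V : Set) : Set where
  con  : ℚ → Poly V
  var  : V → Poly V
  _⊕_  : Poly V → Poly V → Poly V
  _⊗_  : Poly V → Poly V → Poly V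
  neg  : Poly V → Poly V

eval : {V : Set} → (V → ℚ) → Poly V → ℚ
eval ρ (con c) = c
eval ρ (var v) = ρ v
eval ρ (p ⊕ q) = eval ρ p +ℚ eval ρ q
eval ρ (p ⊗ q) = eval ρ p *ℚ eval ρ q
eval ρ (neg p) = -ℚ eval ρ p

_≈P_ : {V : Set} → Poly V → Poly V → Set
p ≈P q = ∀ ρ → eval ρ p ≡ eval ρ q

data Ideal {V : Set} (G : Poly V → Set) : Poly V → Set where
  gen  : ∀ {p} → G p → Ideal G p
  zer  : Ideal G (con 0ℚ)
  add  : ∀ {p q} → Ideal G p → Ideal G q → Ideal G (p ⊕ q)
  mul  : ∀ {p} (a : Poly V) → Ideal G p → Ideal G (a ⊗ p)
  resp : ∀ {p q} → p ≈P q → Ideal G p → Ideal G q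

e : {V : Set} → ℕ → List (Poly V) → Poly V
e zero    _        = con 1ℚ
e (suc r) []       = con 0ℚ
e (suc r) (x ∷ xs) = e (suc r) xs ⊕ x ⊗ e r xs

h : {V : Set} → ℕ → List (Poly V) → Poly V
h zero    _        = con 1ℚ
h (suc r) []       = con 0ℚ
h (suc r) (x ∷ xs) = h (suc r) xs ⊕ x ⊗ h r (x ∷ xs)

_^P_ : {V : Set} → Poly V → ℕ → Poly V
p ^P zero  = con 1ℚ
p ^P suc m = p ⊗ (p ^P m)

signed : {V : Set} → ℕ → Poly V → Poly V
signed zero    p = p
signed (suc i) p = neg (signed i p)

sumTo : {V : Set} → ℕ → (ℕ → Poly V) → Poly V
sumTo zero    f = f zero
sumTo (suc r) f = sumTo r f ⊕ f (suc r)

altSum : {V : Set} → ℕ → (ℕ → Poly V) → (ℕ → Poly V) → Poly V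
altSum r a b = sumTo r (λ i → signed i (a (r ∸ i) ⊗ b i))

data Var (n k d : ℕ) : Set where
  x : Fin n → Var n k d
  y : Fin d → Var n k d
  t : Fin k → Var n k d

listFin : (m : ℕ) → List (Fin m)
listFin zero    = []
listFin (suc m) = Fin.zero ∷ Data.List.map Fin.suc (listFin m)
  where import Data.Fin as Fin
        import Data.List

xs : (n k d : ℕ) → List (Poly (Var n k d))
xs n k d = Data.List.map (λ i → var (x i)) (listFin n)

ys : (n k d : ℕ) → List (Poly (Var n k d))
ys n k d = Data.List.map (λ i → var (y i)) (listFin d)

ts : (n k d : ℕ) → List (Poly (Var n k d))
ts n k d = Data.List.map (λ i → var (t i)) (listFin k)

data JGen (n k d : ℕ) : Poly (Var n k d) → Set where
  genT : (r : ℕ) → k ∸ d < r →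
         JGen n k d (altSum r (λ j → e j (ts n k d)) (λ i → h i (ys n k d)))
  genX : (r : ℕ) → n ∸ d < r →
         JGen n k d (altSum r (λ j → e j (xs n k d)) (λ i → h i (ys n k d)))
  genP : (i : Fin n) →
         JGen n k d (altSum d (λ j → var (x i) ^P j) (λ j → e j (ys n k d)))

J : (n k d : ℕ) → Poly (Var n k d) → Set
J n k d = Ideal (JGen n k d)

Z : (n k d : ℕ) → (Var n k d → ℚ) → Set
Z n k d ρ =
  (Σ (Fin d → Fin k) λ f → Injective _≡_ _≡_ f × (∀ i → ρ (y i) ≡ ρ (t (f i))))
  × (Σ (Fin n → Fin d) λ g → Surjective _≡_ _≡_ g × (∀ j → ρ (x j) ≡ ρ (y (g j))))

IZ : (n k d : ℕ) → Poly (Var n k d) → Set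
IZ n k d p = ∀ ρ → Z n k d ρ → eval ρ p ≡ 0ℚ

-- Write E_A(z) = ∏_{a ∈ A} (1 + a z) and H_B(z) = ∏_{b ∈ B} 1 / (1 - b z) for the
-- generating series of the e_r and h_r.  At a point of Z the t-values (and likewise the
-- x-values) are, up to order, the y-values B together with k - d (resp. n - d) further
-- values C.  The first two families of generators are then the coefficients of
-- E_{B ++ C}(z) H_B(-z) = E_C(z) in degrees above |C|, which vanish.  Each x_i equals some
-- y_j, and the third generator is ∏_j (x_i - y_j), so it vanishes too.

module Submission where

open import Defs
open import Data.Nat using (ℕ; zero; suc; _∸_; _<_; _≤_; z≤n; s≤s)
import Data.Nat as ℕ
open import Data.Nat.Properties using (m≤n⇒m≤1+n; ≤-refl; +-∸-assoc; n∸n≡0; m+n∸m≡n)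
open import Data.Fin using (Fin)
import Data.Fin as Fin
open import Data.Rational using (ℚ; 0ℚ; 1ℚ; _+_; _*_; -_)
open import Data.Rational.Properties
  using ( +-*-commutativeRing; _≟_; *-identityˡ; *-identityʳ; *-zeroˡ; *-zeroʳ; *-assoc
        ; neg-distribˡ-*)
open import Data.List using (List; []; _∷_; _++_; length; map; allFin)
open import Data.List.Properties
  using (map-∘; map-++; map-cong; map-tabulate; length-map; length-++; length-tabulate)
open import Data.List.Membership.Propositional using (_∈_)
open import Data.List.Membership.Propositional.Properties using (∈-∃++; ∈-map⁺; ∈-allFin)
open import Data.List.Relation.Unary.Any using (here; there)
open import Data.List.Relation.Unary.All as All using (All)
open import Data.List.Relation.Unary.AllPairs using (_∷_)
open import Data.List.Relation.Unary.Unique.Propositional using (Unique)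
import Data.List.Relation.Unary.Unique.Propositional.Properties as Unique
open import Data.List.Relation.Binary.Subset.Propositional using (_⊆_)
open import Data.List.Relation.Binary.Permutation.Propositional
  using (_↭_; prep; swap) renaming (refl to ↭-refl; trans to ↭-trans)
open import Data.List.Relation.Binary.Permutation.Propositional.Properties
  using (∈-resp-↭; ↭-length) renaming (shift to ↭-shift; map⁺ to ↭-map⁺)
open import Data.Product using (∃; _×_; _,_; proj₁; proj₂)
open import Data.Empty using (⊥-elim)
open import Function.Base using (id; _∘_)
open import Function.Definitions using (Injective; Surjective)
open import Relation.Binary.PropositionalEquality
  using (_≡_; _≢_; refl; sym; trans; cong; cong₂; subst; subst₂; _≗_; module ≡-Reasoning)
open import Relation.Nullary.Decidable.Core using (dec⇒maybe)
open import Tactic.RingSolver using (solve-∀)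
open import Tactic.RingSolver.Core.AlmostCommutativeRing using (AlmostCommutativeRing; fromCommutativeRing)

open ≡-Reasoning

ℚ-ring : AlmostCommutativeRing _ _
ℚ-ring = fromCommutativeRing +-*-commutativeRing (λ q → dec⇒maybe (0ℚ ≟ q))

sign : ℕ → ℚ
sign zero    = 1ℚ
sign (suc i) = - sign i

sumToℚ : ℕ → (ℕ → ℚ) → ℚ
sumToℚ zero    f = f zero
sumToℚ (suc r) f = sumToℚ r f + f (suc r)

-- Sequences ℕ → ℚ stand for formal power series in z: _⋆_ is their product,
-- shift is multiplication by z, δ is the series 1 and alt substitutes -z for z.

infixl 7 _⋆_

_⋆_ : (ℕ → ℚ) → (ℕ → ℚ) → ℕ → ℚ
(X ⋆ Y) r = sumToℚ r (λ i → X (r ∸ i) * Y i)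

shift : (ℕ → ℚ) → ℕ → ℚ
shift X zero    = 0ℚ
shift X (suc i) = X i

δ : ℕ → ℚ
δ zero    = 1ℚ
δ (suc i) = 0ℚ

alt : (ℕ → ℚ) → ℕ → ℚ
alt X i = sign i * X i

powers : ℚ → ℕ → ℚ
powers a zero    = 1ℚ
powers a (suc j) = a * powers a j

sumToℚ-cong : ∀ r {f g} → (∀ i → i ≤ r → f i ≡ g i) → sumToℚ r f ≡ sumToℚ r g
sumToℚ-cong zero    f≡g = f≡g zero z≤n
sumToℚ-cong (suc r) f≡g =
  cong₂ _+_ (sumToℚ-cong r (λ i i≤r → f≡g i (m≤n⇒m≤1+n i≤r))) (f≡g (suc r) ≤-refl)

sumToℚ-+ : ∀ r f g → sumToℚ r (λ i → f i + g i) ≡ sumToℚ r f + sumToℚ r g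
sumToℚ-+ zero    f g = refl
sumToℚ-+ (suc r) f g =
  trans (cong (_+ (f (suc r) + g (suc r))) (sumToℚ-+ r f g))
        (interchange (sumToℚ r f) (sumToℚ r g) (f (suc r)) (g (suc r)))
  where
  interchange : ∀ a b c d → (a + b) + (c + d) ≡ (a + c) + (b + d)
  interchange = solve-∀ ℚ-ring

sumToℚ-*ˡ : ∀ r c f → sumToℚ r (λ i → c * f i) ≡ c * sumToℚ r f
sumToℚ-*ˡ zero    c f = refl
sumToℚ-*ˡ (suc r) c f =
  trans (cong (_+ c * f (suc r)) (sumToℚ-*ˡ r c f)) (distrib c (sumToℚ r f) (f (suc r)))
  where
  distrib : ∀ c a b → c * a + c * b ≡ c * (a + b)
  distrib = solve-∀ ℚ-ring

sumToℚ-sucˡ : ∀ r f → sumToℚ (suc r) f ≡ f zero + sumToℚ r (f ∘ suc)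
sumToℚ-sucˡ zero    f = refl
sumToℚ-sucˡ (suc r) f =
  trans (cong (_+ f (suc (suc r))) (sumToℚ-sucˡ r f))
        (assoc (f zero) (sumToℚ r (f ∘ suc)) (f (suc (suc r))))
  where
  assoc : ∀ a b c → (a + b) + c ≡ a + (b + c)
  assoc = solve-∀ ℚ-ring

sumToℚ-zero : ∀ r f → (∀ i → f i ≡ 0ℚ) → sumToℚ r f ≡ 0ℚ
sumToℚ-zero zero    f f≡0 = f≡0 zero
sumToℚ-zero (suc r) f f≡0 = cong₂ _+_ (sumToℚ-zero r f f≡0) (f≡0 (suc r))

⋆-cong : ∀ {X X' Y Y'} → X ≗ X' → Y ≗ Y' → X ⋆ Y ≗ X' ⋆ Y'
⋆-cong X≗X' Y≗Y' r = sumToℚ-cong r (λ i _ → cong₂ _*_ (X≗X' (r ∸ i)) (Y≗Y' i))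

⋆-congˡ : ∀ {X X'} Y → X ≗ X' → X ⋆ Y ≗ X' ⋆ Y
⋆-congˡ Y X≗X' = ⋆-cong {Y = Y} X≗X' (λ _ → refl)

⋆-congʳ : ∀ X {Y Y'} → Y ≗ Y' → X ⋆ Y ≗ X ⋆ Y'
⋆-congʳ X = ⋆-cong {X} (λ _ → refl)

⋆-linearˡ : ∀ X c Z Y r → ((λ i → X i + c * Z i) ⋆ Y) r ≡ (X ⋆ Y) r + c * (Z ⋆ Y) r
⋆-linearˡ X c Z Y r = begin
  sumToℚ r (λ i → (X (r ∸ i) + c * Z (r ∸ i)) * Y i)
    ≡⟨ sumToℚ-cong r (λ i _ → distrib (X (r ∸ i)) c (Z (r ∸ i)) (Y i)) ⟩
  sumToℚ r (λ i → X (r ∸ i) * Y i + c * (Z (r ∸ i) * Y i))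
    ≡⟨ sumToℚ-+ r _ _ ⟩
  (X ⋆ Y) r + sumToℚ r (λ i → c * (Z (r ∸ i) * Y i))
    ≡⟨ cong ((X ⋆ Y) r +_) (sumToℚ-*ˡ r c _) ⟩
  (X ⋆ Y) r + c * (Z ⋆ Y) r ∎
  where
  distrib : ∀ a c b y → (a + c * b) * y ≡ a * y + c * (b * y)
  distrib = solve-∀ ℚ-ring

⋆-linearʳ : ∀ X Y c W r → (X ⋆ (λ i → Y i + c * W i)) r ≡ (X ⋆ Y) r + c * (X ⋆ W) r
⋆-linearʳ X Y c W r = begin
  sumToℚ r (λ i → X (r ∸ i) * (Y i + c * W i))
    ≡⟨ sumToℚ-cong r (λ i _ → distrib (X (r ∸ i)) (Y i) c (W i)) ⟩
  sumToℚ r (λ i → X (r ∸ i) * Y i + c * (X (r ∸ i) * W i))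
    ≡⟨ sumToℚ-+ r _ _ ⟩
  (X ⋆ Y) r + sumToℚ r (λ i → c * (X (r ∸ i) * W i))
    ≡⟨ cong ((X ⋆ Y) r +_) (sumToℚ-*ˡ r c _) ⟩
  (X ⋆ Y) r + c * (X ⋆ W) r ∎
  where
  distrib : ∀ a y c w → a * (y + c * w) ≡ a * y + c * (a * w)
  distrib = solve-∀ ℚ-ring

⋆-shiftʳ : ∀ X Y r → (X ⋆ shift Y) (suc r) ≡ (X ⋆ Y) r
⋆-shiftʳ X Y r = trans (sumToℚ-sucˡ r _) (drop-zero (X (suc r)) ((X ⋆ Y) r))
  where
  drop-zero : ∀ a b → a * 0ℚ + b ≡ b
  drop-zero = solve-∀ ℚ-ring

⋆-shiftˡ : ∀ X Y r → (shift X ⋆ Y) (suc r) ≡ (X ⋆ Y) r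
⋆-shiftˡ X Y r = begin
  sumToℚ r (λ i → shift X (suc r ∸ i) * Y i) + shift X (r ∸ r) * Y (suc r)
    ≡⟨ cong₂ _+_ (sumToℚ-cong r (λ i i≤r → cong (λ j → shift X j * Y i) (+-∸-assoc 1 i≤r)))
                 (cong (λ j → shift X j * Y (suc r)) (n∸n≡0 r)) ⟩
  (X ⋆ Y) r + 0ℚ * Y (suc r)
    ≡⟨ drop-zero ((X ⋆ Y) r) (Y (suc r)) ⟩
  (X ⋆ Y) r ∎
  where
  drop-zero : ∀ a b → a + 0ℚ * b ≡ a
  drop-zero = solve-∀ ℚ-ring

shift-⋆ : ∀ X Y → shift X ⋆ Y ≗ X ⋆ shift Y
shift-⋆ X Y zero    = trans (*-zeroˡ (Y zero)) (sym (*-zeroʳ (X zero)))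
shift-⋆ X Y (suc r) = trans (⋆-shiftˡ X Y r) (sym (⋆-shiftʳ X Y r))

⋆-identityʳ : ∀ X → X ⋆ δ ≗ X
⋆-identityʳ X zero    = *-identityʳ (X zero)
⋆-identityʳ X (suc r) = begin
  (X ⋆ δ) (suc r)
    ≡⟨ sumToℚ-sucˡ r _ ⟩
  X (suc r) * 1ℚ + sumToℚ r (λ i → X (r ∸ i) * 0ℚ)
    ≡⟨ cong (X (suc r) * 1ℚ +_) (sumToℚ-zero r _ (λ i → *-zeroʳ (X (r ∸ i)))) ⟩
  X (suc r) * 1ℚ + 0ℚ
    ≡⟨ unit (X (suc r)) ⟩
  X (suc r) ∎
  where
  unit : ∀ a → a * 1ℚ + 0ℚ ≡ a
  unit = solve-∀ ℚ-ring

powers-⋆ : ∀ a Y m → (powers a ⋆ Y) (suc m) ≡ a * (powers a ⋆ Y) m + Y (suc m)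
powers-⋆ a Y m = begin
  sumToℚ m (λ i → powers a (suc m ∸ i) * Y i) + powers a (m ∸ m) * Y (suc m)
    ≡⟨ cong₂ _+_ (sumToℚ-cong m (λ i i≤m → trans (cong (λ j → powers a j * Y i) (+-∸-assoc 1 i≤m))
                                                  (*-assoc a (powers a (m ∸ i)) (Y i))))
                 (cong (λ j → powers a j * Y (suc m)) (n∸n≡0 m)) ⟩
  sumToℚ m (λ i → a * (powers a (m ∸ i) * Y i)) + 1ℚ * Y (suc m)
    ≡⟨ cong₂ _+_ (sumToℚ-*ˡ m a _) (*-identityˡ (Y (suc m))) ⟩
  a * (powers a ⋆ Y) m + Y (suc m) ∎

-- eℚ A and hℚ B are the coefficient sequences of E_A and H_B.

eℚ : List ℚ → ℕ → ℚ
eℚ _       zero    = 1ℚ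
eℚ []      (suc r) = 0ℚ
eℚ (a ∷ A) (suc r) = eℚ A (suc r) + a * eℚ A r

hℚ : List ℚ → ℕ → ℚ
hℚ _       zero    = 1ℚ
hℚ []      (suc r) = 0ℚ
hℚ (b ∷ B) (suc r) = hℚ B (suc r) + b * hℚ (b ∷ B) r

eℚ-∷ : ∀ b A → eℚ (b ∷ A) ≗ (λ i → eℚ A i + b * shift (eℚ A) i)
eℚ-∷ b A zero    = sym (absorb b)
  where
  absorb : ∀ b → 1ℚ + b * 0ℚ ≡ 1ℚ
  absorb = solve-∀ ℚ-ring
eℚ-∷ b A (suc i) = refl

eℚ-∷-cong : ∀ a {A A'} → eℚ A ≗ eℚ A' → eℚ (a ∷ A) ≗ eℚ (a ∷ A')
eℚ-∷-cong a A≗A' zero    = refl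
eℚ-∷-cong a A≗A' (suc i) = cong₂ (λ u v → u + a * v) (A≗A' (suc i)) (A≗A' i)

eℚ-swap : ∀ a b A → eℚ (a ∷ b ∷ A) ≗ eℚ (b ∷ a ∷ A)
eℚ-swap a b A zero    = refl
eℚ-swap a b A (suc i) = begin
  eℚ A (suc i) + b * eℚ A i + a * eℚ (b ∷ A) i
    ≡⟨ cong (λ v → eℚ A (suc i) + b * eℚ A i + a * v) (eℚ-∷ b A i) ⟩
  eℚ A (suc i) + b * eℚ A i + a * (eℚ A i + b * shift (eℚ A) i)
    ≡⟨ exchange (eℚ A (suc i)) (eℚ A i) (shift (eℚ A) i) a b ⟩
  eℚ A (suc i) + a * eℚ A i + b * (eℚ A i + a * shift (eℚ A) i)
    ≡⟨ cong (λ v → eℚ A (suc i) + a * eℚ A i + b * v) (eℚ-∷ a A i) ⟨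
  eℚ A (suc i) + a * eℚ A i + b * eℚ (a ∷ A) i ∎
  where
  exchange : ∀ p q r a b → p + b * q + a * (q + b * r) ≡ p + a * q + b * (q + a * r)
  exchange = solve-∀ ℚ-ring

eℚ-↭ : ∀ {A A'} → A ↭ A' → eℚ A ≗ eℚ A'
eℚ-↭ ↭-refl         i = refl
eℚ-↭ (prep a p)     i = eℚ-∷-cong a (eℚ-↭ p) i
eℚ-↭ (swap a b p)   i = trans (eℚ-swap a b _ i) (eℚ-∷-cong b (eℚ-∷-cong a (eℚ-↭ p)) i)
eℚ-↭ (↭-trans p q)  i = trans (eℚ-↭ p i) (eℚ-↭ q i)

eℚ-vanishes : ∀ C r → length C < r → eℚ C r ≡ 0ℚ
eℚ-vanishes []      (suc r) _          = refl
eℚ-vanishes (c ∷ C) (suc r) (s≤s ∣C∣<r) =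
  trans (cong₂ (λ u v → u + c * v) (eℚ-vanishes C (suc r) (m≤n⇒m≤1+n ∣C∣<r))
                                   (eℚ-vanishes C r ∣C∣<r))
        (zero-sum c)
  where
  zero-sum : ∀ c → 0ℚ + c * 0ℚ ≡ 0ℚ
  zero-sum = solve-∀ ℚ-ring

alt-hℚ-∷ : ∀ b B i → alt (hℚ (b ∷ B)) i + b * shift (alt (hℚ (b ∷ B))) i ≡ alt (hℚ B) i
alt-hℚ-∷ b B zero    = unit b
  where
  unit : ∀ b → 1ℚ * 1ℚ + b * 0ℚ ≡ 1ℚ * 1ℚ
  unit = solve-∀ ℚ-ring
alt-hℚ-∷ b B (suc i) = telescope (sign i) (hℚ B (suc i)) b (hℚ (b ∷ B) i)
  where
  telescope : ∀ s p b q → - s * (p + b * q) + b * (s * q) ≡ - s * p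
  telescope = solve-∀ ℚ-ring

alt-hℚ-[] : alt (hℚ []) ≗ δ
alt-hℚ-[] zero    = *-identityʳ 1ℚ
alt-hℚ-[] (suc i) = *-zeroʳ (- sign i)

alt-eℚ-∷ : ∀ a A → alt (eℚ (a ∷ A)) ≗ (λ i → alt (eℚ A) i + (- a) * shift (alt (eℚ A)) i)
alt-eℚ-∷ a A zero    = unit a
  where
  unit : ∀ a → 1ℚ * 1ℚ ≡ 1ℚ * 1ℚ + (- a) * 0ℚ
  unit = solve-∀ ℚ-ring
alt-eℚ-∷ a A (suc i) = expand (sign i) (eℚ A (suc i)) a (eℚ A i)
  where
  expand : ∀ s p a q → - s * (p + a * q) ≡ - s * p + (- a) * (s * q)
  expand = solve-∀ ℚ-ring

eℚ⋆alt-hℚ-cancel : ∀ b A B → eℚ (b ∷ A) ⋆ alt (hℚ (b ∷ B)) ≗ eℚ A ⋆ alt (hℚ B)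
eℚ⋆alt-hℚ-cancel b A B r = begin
  (eℚ (b ∷ A) ⋆ H) r
    ≡⟨ ⋆-congˡ H (eℚ-∷ b A) r ⟩
  ((λ i → eℚ A i + b * shift (eℚ A) i) ⋆ H) r
    ≡⟨ ⋆-linearˡ (eℚ A) b (shift (eℚ A)) H r ⟩
  (eℚ A ⋆ H) r + b * (shift (eℚ A) ⋆ H) r
    ≡⟨ cong (λ u → (eℚ A ⋆ H) r + b * u) (shift-⋆ (eℚ A) H r) ⟩
  (eℚ A ⋆ H) r + b * (eℚ A ⋆ shift H) r
    ≡⟨ ⋆-linearʳ (eℚ A) H b (shift H) r ⟨
  (eℚ A ⋆ (λ i → H i + b * shift H i)) r
    ≡⟨ ⋆-congʳ (eℚ A) (alt-hℚ-∷ b B) r ⟩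
  (eℚ A ⋆ alt (hℚ B)) r ∎
  where
  H : ℕ → ℚ
  H = alt (hℚ (b ∷ B))

eℚ⋆alt-hℚ : ∀ B {A C} → A ↭ B ++ C → eℚ A ⋆ alt (hℚ B) ≗ eℚ C
eℚ⋆alt-hℚ []      {C = C} A↭C r = trans (⋆-cong (eℚ-↭ A↭C) alt-hℚ-[] r) (⋆-identityʳ (eℚ C) r)
eℚ⋆alt-hℚ (b ∷ B) {C = C} A↭ r = begin
  (eℚ _ ⋆ alt (hℚ (b ∷ B))) r
    ≡⟨ ⋆-congˡ (alt (hℚ (b ∷ B))) (eℚ-↭ A↭) r ⟩
  (eℚ (b ∷ B ++ C) ⋆ alt (hℚ (b ∷ B))) r
    ≡⟨ eℚ⋆alt-hℚ-cancel b (B ++ C) B r ⟩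
  (eℚ (B ++ C) ⋆ alt (hℚ B)) r
    ≡⟨ eℚ⋆alt-hℚ B ↭-refl r ⟩
  eℚ C r ∎

∈⇒↭∷ : ∀ {A : Set} {a : A} {as} → a ∈ as → ∃ λ bs → as ↭ a ∷ bs
∈⇒↭∷ a∈as with us , vs , refl ← ∈-∃++ a∈as = us ++ vs , ↭-shift _ us vs

powers⋆alt-eℚ-root : ∀ {a A} → a ∈ A → (powers a ⋆ alt (eℚ A)) (length A) ≡ 0ℚ
powers⋆alt-eℚ-root {a} {A} a∈A with A' , A↭ ← ∈⇒↭∷ a∈A rewrite ↭-length A↭ = begin
  (powers a ⋆ alt (eℚ A)) (suc m)
    ≡⟨ ⋆-congʳ (powers a) (λ i → cong (sign i *_) (eℚ-↭ A↭ i)) (suc m) ⟩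
  (powers a ⋆ alt (eℚ (a ∷ A'))) (suc m)
    ≡⟨ ⋆-congʳ (powers a) (alt-eℚ-∷ a A') (suc m) ⟩
  (powers a ⋆ (λ i → E' i + (- a) * shift E' i)) (suc m)
    ≡⟨ ⋆-linearʳ (powers a) E' (- a) (shift E') (suc m) ⟩
  (powers a ⋆ E') (suc m) + (- a) * (powers a ⋆ shift E') (suc m)
    ≡⟨ cong₂ (λ u v → u + (- a) * v) (powers-⋆ a E' m) (⋆-shiftʳ (powers a) E' m) ⟩
  a * c + sign (suc m) * eℚ A' (suc m) + (- a) * c
    ≡⟨ cong (λ u → a * c + sign (suc m) * u + (- a) * c) (eℚ-vanishes A' (suc m) ≤-refl) ⟩
  a * c + sign (suc m) * 0ℚ + (- a) * c
    ≡⟨ cancel a c (sign (suc m)) ⟩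
  0ℚ ∎
  where
  m = length A'
  E' = alt (eℚ A')
  c = (powers a ⋆ E') m
  cancel : ∀ a c s → a * c + s * 0ℚ + (- a) * c ≡ 0ℚ
  cancel = solve-∀ ℚ-ring

eval-e : ∀ {V} (ρ : V → ℚ) ps r → eval ρ (e r ps) ≡ eℚ (map (eval ρ) ps) r
eval-e ρ ps       zero    = refl
eval-e ρ []       (suc r) = refl
eval-e ρ (p ∷ ps) (suc r) =
  cong₂ (λ u v → u + eval ρ p * v) (eval-e ρ ps (suc r)) (eval-e ρ ps r)

eval-h : ∀ {V} (ρ : V → ℚ) ps r → eval ρ (h r ps) ≡ hℚ (map (eval ρ) ps) r
eval-h ρ ps       zero    = refl
eval-h ρ []       (suc r) = refl
eval-h ρ (p ∷ ps) (suc r) =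
  cong₂ (λ u v → u + eval ρ p * v) (eval-h ρ ps (suc r)) (eval-h ρ (p ∷ ps) r)

eval-^P : ∀ {V} (ρ : V → ℚ) p j → eval ρ (p ^P j) ≡ powers (eval ρ p) j
eval-^P ρ p zero    = refl
eval-^P ρ p (suc j) = cong (eval ρ p *_) (eval-^P ρ p j)

eval-signed : ∀ {V} (ρ : V → ℚ) i p → eval ρ (signed i p) ≡ sign i * eval ρ p
eval-signed ρ zero    p = sym (*-identityˡ (eval ρ p))
eval-signed ρ (suc i) p = trans (cong -_ (eval-signed ρ i p)) (neg-distribˡ-* (sign i) (eval ρ p))

eval-sumTo : ∀ {V} (ρ : V → ℚ) r f → eval ρ (sumTo r f) ≡ sumToℚ r (eval ρ ∘ f)
eval-sumTo ρ zero    f = refl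
eval-sumTo ρ (suc r) f = cong (_+ eval ρ (f (suc r))) (eval-sumTo ρ r f)

eval-altSum : ∀ {V} (ρ : V → ℚ) r a b →
  eval ρ (altSum r a b) ≡ ((eval ρ ∘ a) ⋆ alt (eval ρ ∘ b)) r
eval-altSum ρ r a b = trans (eval-sumTo ρ r _) (sumToℚ-cong r (λ i _ →
  trans (eval-signed ρ i _) (move-sign (sign i) (eval ρ (a (r ∸ i))) (eval ρ (b i)))))
  where
  move-sign : ∀ s p q → s * (p * q) ≡ p * (s * q)
  move-sign = solve-∀ ℚ-ring

altSum-e-h-vanishes : ∀ {V} (ρ : V → ℚ) r (As Bs : List (Poly V)) {C} →
  map (eval ρ) As ↭ map (eval ρ) Bs ++ C → length C < r →
  eval ρ (altSum r (λ j → e j As) (λ i → h i Bs)) ≡ 0ℚ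
altSum-e-h-vanishes ρ r As Bs {C} As↭ ∣C∣<r = begin
  eval ρ (altSum r (λ j → e j As) (λ i → h i Bs))
    ≡⟨ eval-altSum ρ r (λ j → e j As) (λ i → h i Bs) ⟩
  ((λ j → eval ρ (e j As)) ⋆ alt (λ i → eval ρ (h i Bs))) r
    ≡⟨ ⋆-cong (eval-e ρ As) (λ i → cong (sign i *_) (eval-h ρ Bs i)) r ⟩
  (eℚ (map (eval ρ) As) ⋆ alt (hℚ (map (eval ρ) Bs))) r
    ≡⟨ eℚ⋆alt-hℚ (map (eval ρ) Bs) As↭ r ⟩
  eℚ C r
    ≡⟨ eℚ-vanishes C r ∣C∣<r ⟩
  0ℚ ∎

altSum-powers-e-vanishes : ∀ {V} (ρ : V → ℚ) q (Ys : List (Poly V)) {m} → length Ys ≡ m →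
  eval ρ q ∈ map (eval ρ) Ys → eval ρ (altSum m (λ j → q ^P j) (λ j → e j Ys)) ≡ 0ℚ
altSum-powers-e-vanishes ρ q Ys refl q∈Ys = begin
  eval ρ (altSum (length Ys) (λ j → q ^P j) (λ j → e j Ys))
    ≡⟨ eval-altSum ρ (length Ys) (λ j → q ^P j) (λ j → e j Ys) ⟩
  ((λ j → eval ρ (q ^P j)) ⋆ alt (λ i → eval ρ (e i Ys))) (length Ys)
    ≡⟨ ⋆-cong (eval-^P ρ q) (λ i → cong (sign i *_) (eval-e ρ Ys i)) (length Ys) ⟩
  (powers (eval ρ q) ⋆ alt (eℚ (map (eval ρ) Ys))) (length Ys)
    ≡⟨ cong (powers (eval ρ q) ⋆ alt (eℚ (map (eval ρ) Ys))) (length-map (eval ρ) Ys) ⟨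
  (powers (eval ρ q) ⋆ alt (eℚ (map (eval ρ) Ys))) (length (map (eval ρ) Ys))
    ≡⟨ powers⋆alt-eℚ-root q∈Ys ⟩
  0ℚ ∎

listFin≡allFin : ∀ m → listFin m ≡ allFin m
listFin≡allFin zero    = refl
listFin≡allFin (suc m) =
  cong (Fin.zero ∷_) (trans (cong (map Fin.suc) (listFin≡allFin m)) (map-tabulate id Fin.suc))

⊆-∷-↭ : ∀ {A : Set} {a : A} {as bs cs} → All (a ≢_) as → a ∷ as ⊆ bs → bs ↭ a ∷ cs → as ⊆ cs
⊆-∷-↭ a∉as a∷as⊆bs bs↭ {c} c∈as with ∈-resp-↭ bs↭ (a∷as⊆bs (there c∈as))
... | here c≡a    = ⊥-elim (All.lookup a∉as c∈as (sym c≡a))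
... | there c∈cs  = c∈cs

Unique-⊆⇒↭++ : ∀ {A : Set} {as bs : List A} → Unique as → as ⊆ bs → ∃ λ cs → bs ↭ as ++ cs
Unique-⊆⇒↭++ {as = []}    {bs} _ _ = bs , ↭-refl
Unique-⊆⇒↭++ {as = a ∷ as} (a∉as ∷ as-unique) a∷as⊆bs
  with bs' , bs↭ ← ∈⇒↭∷ (a∷as⊆bs (here refl))
  with cs , bs'↭ ← Unique-⊆⇒↭++ as-unique (⊆-∷-↭ a∉as a∷as⊆bs bs↭)
  = cs , ↭-trans bs↭ (prep a bs'↭)

allFin-↭-image : ∀ {d m} (s : Fin d → Fin m) → Injective _≡_ _≡_ s →
  ∃ λ C → allFin m ↭ map s (allFin d) ++ C × length C ≡ m ∸ d
allFin-↭-image {d} {m} s s-inj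
  with C , allFin↭ ← Unique-⊆⇒↭++ (Unique.map⁺ s-inj (Unique.allFin⁺ d)) (λ _ → ∈-allFin _)
  = C , allFin↭ , trans (sym (m+n∸m≡n d (length C))) (cong (_∸ d) d+∣C∣≡m)
  where
  d+∣C∣≡m : d ℕ.+ length C ≡ m
  d+∣C∣≡m = begin
    d ℕ.+ length C                          ≡⟨ cong (ℕ._+ length C) ∣image∣≡d ⟨
    length (map s (allFin d)) ℕ.+ length C  ≡⟨ length-++ (map s (allFin d)) ⟨
    length (map s (allFin d) ++ C)          ≡⟨ ↭-length allFin↭ ⟨
    length (allFin m)                       ≡⟨ length-tabulate id ⟩
    m                                       ∎
    where
    ∣image∣≡d : length (map s (allFin d)) ≡ d
    ∣image∣≡d = trans (length-map s (allFin d)) (length-tabulate id)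

varList : ∀ {V : Set} {m} → (Fin m → V) → List (Poly V)
varList {m = m} u = map (λ i → var (u i)) (listFin m)

map-eval-varList : ∀ {V} (ρ : V → ℚ) {m} (u : Fin m → V) →
  map (eval ρ) (varList u) ≡ map (ρ ∘ u) (allFin m)
map-eval-varList ρ {m} u = trans (sym (map-∘ (listFin m))) (cong (map (ρ ∘ u)) (listFin≡allFin m))

length-varList : ∀ {V : Set} {m} (u : Fin m → V) → length (varList u) ≡ m
length-varList {m = m} u =
  trans (length-map _ (listFin m)) (trans (cong length (listFin≡allFin m)) (length-tabulate id))

varList-↭ : ∀ {V} (ρ : V → ℚ) {m d} (u : Fin m → V) (w : Fin d → V) (s : Fin d → Fin m) →
  Injective _≡_ _≡_ s → (∀ i → ρ (u (s i)) ≡ ρ (w i)) →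
  ∃ λ C → map (eval ρ) (varList u) ↭ map (eval ρ) (varList w) ++ C × length C ≡ m ∸ d
varList-↭ ρ {m} {d} u w s s-inj u∘s≡w
  with C , allFin↭ , ∣C∣≡m∸d ← allFin-↭-image s s-inj
  = map (ρ ∘ u) C , perm , trans (length-map (ρ ∘ u) C) ∣C∣≡m∸d
  where
  perm : map (eval ρ) (varList u) ↭ map (eval ρ) (varList w) ++ map (ρ ∘ u) C
  perm = subst₂ _↭_ (sym (map-eval-varList ρ u)) image≡ (↭-map⁺ (ρ ∘ u) allFin↭)
    where
    image≡ : map (ρ ∘ u) (map s (allFin d) ++ C) ≡ map (eval ρ) (varList w) ++ map (ρ ∘ u) C
    image≡ = begin
      map (ρ ∘ u) (map s (allFin d) ++ C)
        ≡⟨ map-++ (ρ ∘ u) (map s (allFin d)) C ⟩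
      map (ρ ∘ u) (map s (allFin d)) ++ map (ρ ∘ u) C
        ≡⟨ cong (_++ map (ρ ∘ u) C) (map-∘ (allFin d)) ⟨
      map (ρ ∘ u ∘ s) (allFin d) ++ map (ρ ∘ u) C
        ≡⟨ cong (_++ map (ρ ∘ u) C) (map-cong u∘s≡w (allFin d)) ⟩
      map (ρ ∘ w) (allFin d) ++ map (ρ ∘ u) C
        ≡⟨ cong (_++ map (ρ ∘ u) C) (map-eval-varList ρ w) ⟨
      map (eval ρ) (varList w) ++ map (ρ ∘ u) C ∎

section-of-surjective : ∀ {A B : Set} {g : A → B} → Surjective _≡_ _≡_ g →
  ∃ λ s → Injective _≡_ _≡_ s × (∀ b → g (s b) ≡ b)
section-of-surjective {g = g} g-surj = s , s-inj , g∘s≡id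
  where
  s = λ b → proj₁ (g-surj b)
  g∘s≡id : ∀ b → g (s b) ≡ b
  g∘s≡id b = proj₂ (g-surj b) refl
  s-inj : Injective _≡_ _≡_ s
  s-inj {b} {b'} sb≡sb' = trans (sym (g∘s≡id b)) (trans (cong g sb≡sb') (g∘s≡id b'))

Ideal-vanishes : ∀ {V} {G : Poly V → Set} {ρ : V → ℚ} →
  (∀ {p} → G p → eval ρ p ≡ 0ℚ) → ∀ {p} → Ideal G p → eval ρ p ≡ 0ℚ
Ideal-vanishes G-vanishes (gen p∈G)     = G-vanishes p∈G
Ideal-vanishes G-vanishes zer           = refl
Ideal-vanishes G-vanishes (add p∈I q∈I) =
  cong₂ _+_ (Ideal-vanishes G-vanishes p∈I) (Ideal-vanishes G-vanishes q∈I)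
Ideal-vanishes {ρ = ρ} G-vanishes (mul a p∈I) =
  trans (cong (eval ρ a *_) (Ideal-vanishes G-vanishes p∈I)) (*-zeroʳ (eval ρ a))
Ideal-vanishes {ρ = ρ} G-vanishes (resp p≈q p∈I) =
  trans (sym (p≈q ρ)) (Ideal-vanishes G-vanishes p∈I)

JGen-vanishes : ∀ {n k d ρ p} → Z n k d ρ → JGen n k d p → eval ρ p ≡ 0ℚ
JGen-vanishes {n} {k} {d} {ρ} ((f , f-inj , y≡t∘f) , _) (genT r k∸d<r)
  with C , perm , ∣C∣≡k∸d ← varList-↭ ρ t y f f-inj (sym ∘ y≡t∘f)
  = altSum-e-h-vanishes ρ r (ts n k d) (ys n k d) perm (subst (_< r) (sym ∣C∣≡k∸d) k∸d<r)
JGen-vanishes {n} {k} {d} {ρ} (_ , g , g-surj , x≡y∘g) (genX r n∸d<r)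
  with s , s-inj , g∘s≡id ← section-of-surjective g-surj
  with C , perm , ∣C∣≡n∸d ← varList-↭ ρ x y s s-inj
                              (λ i → trans (x≡y∘g (s i)) (cong (ρ ∘ y) (g∘s≡id i)))
  = altSum-e-h-vanishes ρ r (xs n k d) (ys n k d) perm (subst (_< r) (sym ∣C∣≡n∸d) n∸d<r)
JGen-vanishes {n} {k} {d} {ρ} (_ , g , _ , x≡y∘g) (genP i) =
  altSum-powers-e-vanishes ρ (var (x i)) (ys n k d) (length-varList {m = d} y) xᵢ∈ys
  where
  xᵢ∈ys : ρ (x i) ∈ map (eval ρ) (ys n k d)
  xᵢ∈ys = subst₂ _∈_ (sym (x≡y∘g i)) (sym (map-eval-varList ρ y))
                 (∈-map⁺ (ρ ∘ y) (∈-allFin (g i)))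

lemma3p15 : (n k d : ℕ) → 1 ≤ d → d ≤ k → k ≤ n →
    (p : Poly (Var n k d)) → J n k d p → IZ n k d p
lemma3p15 n k d _ _ _ p p∈J ρ ρ∈Z = Ideal-vanishes (JGen-vanishes ρ∈Z) p∈J
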